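{- Let $\varphi$ be an instance of \textsc{2-Clause 3-SAT} and let $G(\varphi)$ be the graph constructed from $\varphi$ as described in the context. If $\mathrm{wcol}_2(G(\varphi))\le 5$, then $\varphi$ has a satisfying assignment.
   Context: \textsc{2-Clause 3-SAT}: a CNF formula $\varphi$ with clauses $c_1,\dots,c_m$ over variables $x_1,\dots,x_n$, where each clause contains at most 3 variables and each literal ($x_j$ or $\overline{x}_j$) appears in exactly 2 clauses; it is assumed that no variable appears twice in a clause and that every clause has 2 or 3 literals. Construction of $G(\varphi)$: for each clause $c_i$ create 6 vertices $u_i^1,\dots,u_i^6$; if $c_i$ contains only 2 literals, add 2 more vertices $f_i,f_i'$, each adjacent to all of $u_i^1,\dots,u_i^6$. For each variable $x_j$ create two adjacent vertices $v_j$ (for $x_j$) and $v_j'$ (for $\overline{x}_j$). Make $v_j$ adjacent to each of $u_i^1,\dots,u_i^6$ for every clause $c_i$ containing the literal $x_j$, and $v_j'$ adjacent to each of $u_i^1,\dots,u_i^6$ for every clause $c_i$ containing $\overline{x}_j$. Weak coloring number: for a total order $\sigma$ on $V(G)$ and $u\neq v$, $v$ is weakly $r$-reachable from $u$ if $v\not<_\sigma u$ and there is a $u$-$v$ path $P$ of length at most $r$ whose internal vertices $p$ all satisfy $p<_\sigma v$; $\mathrm{wreach}_r(u,G_\sigma)$ is the set of such $v$ and $\mathrm{wcol}_r(G)=\min_\sigma\max_u|\mathrm{wreach}_r(u,G_\sigma)|$ over total orders $\sigma$. -}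

module Defs where

open import Data.Nat using (ℕ; suc; _<_; _≤_)
open import Data.Fin using (Fin)
open import Data.Bool using (Bool; true; false)
open import Data.Product using (Σ; ∃; ∃-syntax; _×_; _,_; proj₁; proj₂)
open import Data.Sum using (_⊎_)
open import Data.List using (List; []; _∷_; _++_; [_]; length; map)
open import Data.List.Membership.Propositional using (_∈_)
open import Data.List.Relation.Unary.All using (All)
open import Data.List.Relation.Unary.Any using (Any)
open import Data.List.Relation.Unary.Linked using (Linked)
open import Data.List.Relation.Unary.Unique.Propositional using (Unique)
open import Relation.Binary.PropositionalEquality using (_≡_; _≢_)
open import Relation.Nullary using (¬_)

record Graph : Set₁ where
  field
    V : Set
    E : V → V → Set

-- A total order σ on V, given by an injective rank function into ℕ
-- (x <σ y iff rank x < rank y).  Every total order on a finite set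
-- arises this way.
record Order (V : Set) : Set where
  field
    rank : V → ℕ
    rank-inj : ∀ {x y} → rank x ≡ rank y → x ≡ y

module _ (G : Graph) where
  open Graph G

  WReach : ℕ → Order V → V → V → Set
  WReach r σ u v =
    u ≢ v × ¬ (rank v < rank u) ×
    ∃[ ps ] ( Linked E (u ∷ ps ++ [ v ])
            × Unique (u ∷ ps ++ [ v ])
            × suc (length ps) ≤ r
            × All (λ p → rank p < rank v) ps )
    where open Order σ

  -- |wreach_r(u, G_σ)| ≤ k : every duplicate-free list of elements of it
  -- has length at most k.
  WReachBound : ℕ → Order V → V → ℕ → Set
  WReachBound r σ u k =
    (xs : List V) → Unique xs → All (WReach r σ u) xs → length xs ≤ k

  wcol≤ : ℕ → ℕ → Set
  wcol≤ r k = Σ (Order V) λ σ → ∀ u → WReachBound r σ u k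

-- literal (j , true) = x_j,  (j , false) = ¬x_j
Literal : ℕ → Set
Literal n = Fin n × Bool

record CNF (n m : ℕ) : Set where
  field
    clause : Fin m → List (Literal n)

record Is2Clause3SAT {n m : ℕ} (φ : CNF n m) : Set where
  open CNF φ
  field
    size : ∀ i → length (clause i) ≡ 2 ⊎ length (clause i) ≡ 3
    no-repeat : ∀ i → Unique (map proj₁ (clause i))
    twice : ∀ (l : Literal n) → Σ (Fin m) λ i₁ → Σ (Fin m) λ i₂ → (i₁ ≢ i₂ × l ∈ clause i₁ × l ∈ clause i₂ ×
              (∀ (i : Fin m) → l ∈ clause i → i ≡ i₁ ⊎ i ≡ i₂))

Satisfiable : {n m : ℕ} → CNF n m → Set
Satisfiable {n} {m} φ =
  Σ (Fin n → Bool) λ α → ∀ (i : Fin m) → Any (λ (l : Literal n) → α (proj₁ l) ≡ proj₂ l) (CNF.clause φ i)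

module _ {n m : ℕ} (φ : CNF n m) where
  open CNF φ

  data GVertex : Set where
    uV : Fin m → Fin 6 → GVertex
    fV : (i : Fin m) → length (clause i) ≡ 2 → Fin 2 → GVertex
    -- vV j true = v_j (for x_j),  vV j false = v_j' (for ¬x_j)
    vV : Fin n → Bool → GVertex

  data GEdge⃗ : GVertex → GVertex → Set where
    f-u : ∀ i (p : length (clause i) ≡ 2) a k → GEdge⃗ (fV i p a) (uV i k)
    v-v' : ∀ j → GEdge⃗ (vV j true) (vV j false)
    lit-u : ∀ j b i k → (j , b) ∈ clause i → GEdge⃗ (vV j b) (uV i k)

  GAdj : GVertex → GVertex → Set
  GAdj x y = GEdge⃗ x y ⊎ GEdge⃗ y x

  Gφ : Graph
  Gφ = record { V = GVertex ; E = GAdj }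

{-# OPTIONS --safe #-}
module Submission where

-- Fix σ with |wreach₂| ≤ 5 and let u_i be the σ-least of u_i^1,…,u_i^6. Any common
-- neighbour x of the six lies above u_i, for otherwise x would weakly 1-reach all six.
-- Make x_j true iff v_j comes after v_j′. If clause c_i were false, each literal
-- vertex x of c_i lies below its complement x̄, so u_i weakly 2-reaches both x (an edge)
-- and x̄ (via x), and also f_i, f_i′ when c_i has two literals: six distinct vertices.

open import Defs
open import Data.Nat using (ℕ; zero; suc; _+_; _<_; _≤_; s≤s; z≤n; _≤?_; _<?_)
open import Data.Nat.Properties
  using (≤-refl; ≤-trans; <⇒≤; ≰⇒>; ≮⇒≥; ≤∧≢⇒<; <-≤-trans; <-trans; <⇒≢; <-asym; 1+n≰n)
open import Data.Fin using (Fin; zero; suc)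
open import Data.Bool using (Bool; true; false; not)
open import Data.Bool.Properties using (¬-not; not-injective) renaming (_≟_ to _≟ᵇ_)
open import Data.Product using (Σ; ∃-syntax; _×_; _,_; proj₁; proj₂)
open import Data.Sum using (inj₁; inj₂; [_,_]′)
open import Data.Empty using (⊥; ⊥-elim)
open import Data.Unit using (⊤)
open import Data.List using (List; []; _++_; [_]; length; map; tabulate)
open import Data.List.Properties using (length-++; length-map; length-tabulate)
open import Data.List.Membership.Propositional using (_∈_)
open import Data.List.Relation.Unary.All as All using (All; []; _∷_)
import Data.List.Relation.Unary.All.Properties as All
open import Data.List.Relation.Unary.Any using (Any; any?)
open import Data.List.Relation.Unary.Linked using ([-]; _∷_)
open import Data.List.Relation.Unary.AllPairs using ([]; _∷_)
open import Data.List.Relation.Unary.Unique.Propositional using (Unique)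
import Data.List.Relation.Unary.Unique.Propositional.Properties as Unique
open import Data.List.Relation.Binary.Disjoint.Propositional using (Disjoint)
open import Function using (_∘_)
open import Relation.Binary.PropositionalEquality using (_≡_; _≢_; refl; sym; cong; cong₂; subst; trans)
open import Relation.Nullary using (¬_; yes; no; does)
open import Relation.Nullary.Decidable using (dec-true; dec-false; decidable-stable)

argmin : ∀ {k} (f : Fin (suc k) → ℕ) → Σ (Fin (suc k)) λ a → ∀ b → f a ≤ f b
argmin {zero} f = zero , λ { zero → ≤-refl }
argmin {suc k} f with argmin (f ∘ suc)
... | a , min with f zero ≤? f (suc a)
... | yes f₀≤ = zero , λ { zero → ≤-refl ; (suc b) → ≤-trans f₀≤ (min b) }
... | no f₀≰ = suc a , λ { zero → <⇒≤ (≰⇒> f₀≰) ; (suc b) → min b }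

All¬⇒Disjoint : ∀ {A : Set} {P : A → Set} {xs ys : List A} →
                All (¬_ ∘ P) xs → All P ys → Disjoint xs ys
All¬⇒Disjoint ¬pxs pys (v∈xs , v∈ys) = All.lookup ¬pxs v∈xs (All.lookup pys v∈ys)

module WeakReachability (G : Graph) (σ : Order (Graph.V G)) where
  open Graph G
  open Order σ

  rank-<⇒≢ : ∀ {u v} → rank u < rank v → u ≢ v
  rank-<⇒≢ lt = <⇒≢ lt ∘ cong rank

  wreach-edge : ∀ {r u v} → 1 ≤ r → E u v → rank u < rank v → WReach G r σ u v
  wreach-edge 1≤r uv u<v =
    rank-<⇒≢ u<v , <-asym u<v , [] , (uv ∷ [-]) , ((rank-<⇒≢ u<v ∷ []) ∷ [] ∷ []) , 1≤r , []

  wreach-path₂ : ∀ {r u x v} → 2 ≤ r → E u x → E x v → rank u < rank x → rank x < rank v →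
                 WReach G r σ u v
  wreach-path₂ 2≤r ux xv u<x x<v =
    rank-<⇒≢ u<v , <-asym u<v , [ _ ] , (ux ∷ xv ∷ [-]) ,
    ((rank-<⇒≢ u<x ∷ rank-<⇒≢ u<v ∷ []) ∷ (rank-<⇒≢ x<v ∷ []) ∷ [] ∷ []) , 2≤r , (x<v ∷ [])
    where u<v = <-trans u<x x<v

  common-neighbour-above-argmin :
    ∀ {r k x} (w : Fin (suc k) → V) → (∀ {a b} → w a ≡ w b → a ≡ b) → 1 ≤ r →
    WReachBound G r σ x k → (∀ a → E x (w a)) →
    let a₀ = proj₁ (argmin (rank ∘ w)) in x ≢ w a₀ → rank (w a₀) < rank x
  common-neighbour-above-argmin {k = k} {x} w w-inj 1≤r bound adj x≢w₀
    with argmin (rank ∘ w)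
  ... | a₀ , min with rank x <? rank (w a₀)
  ... | no x≮w₀ = ≤∧≢⇒< (≮⇒≥ x≮w₀) (x≢w₀ ∘ sym ∘ rank-inj)
  ... | yes x<w₀ = ⊥-elim (1+n≰n (subst (_≤ k) (length-tabulate w)
          (bound (tabulate w) (Unique.tabulate⁺ w-inj)
                 (All.tabulate⁺ λ a → wreach-edge 1≤r (adj a) (<-≤-trans x<w₀ (min a))))))

module Reduction {n m : ℕ} (φ : CNF n m) (H : Is2Clause3SAT φ) (σ : Order (GVertex φ))
                 (bound : ∀ u → WReachBound (Gφ φ) 2 σ u 5) where
  open CNF φ
  open Is2Clause3SAT H
  open Order σ
  open WeakReachability (Gφ φ) σ

  V : Set
  V = GVertex φ

  Reach₂ : V → V → Set
  Reach₂ = WReach (Gφ φ) 2 σ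

  lowest : Fin m → V
  lowest i = uV i (proj₁ (argmin (rank ∘ uV i)))

  clause-neighbour-above-lowest : ∀ i {x} → (∀ a → GAdj φ x (uV i a)) → x ≢ lowest i →
                                  rank (lowest i) < rank x
  clause-neighbour-above-lowest i =
    common-neighbour-above-argmin (uV i) (λ { refl → refl }) (s≤s z≤n) (bound _)

  α : Fin n → Bool
  α j = does (rank (vV j false) <? rank (vV j true))

  Sat : Literal n → Set
  Sat l = α (proj₁ l) ≡ proj₂ l

  false-literal-below-negation : ∀ j b → α j ≢ b → rank (vV j b) < rank (vV j (not b))
  false-literal-below-negation j true α≢true =
    ≤∧≢⇒< (≮⇒≥ (α≢true ∘ dec-true (_ <? _))) (v≢v′ ∘ rank-inj)
    where v≢v′ : vV j true ≢ vV j false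
          v≢v′ ()
  false-literal-below-negation j false α≢false =
    decidable-stable (_ <? _) (α≢false ∘ dec-false (_ <? _))

  literalVertex negatedVertex : Literal n → V
  literalVertex l = vV (proj₁ l) (proj₂ l)
  negatedVertex l = vV (proj₁ l) (not (proj₂ l))

  wreach-literal : ∀ {i l} → l ∈ clause i → Reach₂ (lowest i) (literalVertex l)
  wreach-literal {i} {j , b} l∈c =
    wreach-edge (s≤s z≤n) (inj₂ (lit-u j b i _ l∈c))
      (clause-neighbour-above-lowest i (λ a → inj₁ (lit-u j b i a l∈c)) (λ ()))

  wreach-negated : ∀ {i l} → l ∈ clause i → ¬ Sat l → Reach₂ (lowest i) (negatedVertex l)
  wreach-negated {i} {j , b} l∈c ¬sat =
    wreach-path₂ ≤-refl (inj₂ (lit-u j b i _ l∈c)) (literal-negation-adjacent b)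
      (clause-neighbour-above-lowest i (λ a → inj₁ (lit-u j b i a l∈c)) (λ ()))
      (false-literal-below-negation j b ¬sat)
    where literal-negation-adjacent : ∀ b → GAdj φ (vV j b) (vV j (not b))
          literal-negation-adjacent true = inj₁ (v-v' j)
          literal-negation-adjacent false = inj₂ (v-v' j)

  variableVertices : List (Literal n) → List V
  variableVertices ls = map literalVertex ls ++ map negatedVertex ls

  length-variableVertices : ∀ ls → length (variableVertices ls) ≡ length ls + length ls
  length-variableVertices ls
    rewrite length-++ (map literalVertex ls) {map negatedVertex ls}
          | length-map literalVertex ls | length-map negatedVertex ls = refl

  IsVariableVertex : V → Set
  IsVariableVertex (vV _ _) = ⊤
  IsVariableVertex _ = ⊥

  AgreesWithα : V → Set
  AgreesWithα (vV j b) = α j ≡ b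
  AgreesWithα _ = ⊥

  variableVertices-unique : ∀ ls → Unique (map proj₁ ls) → All (¬_ ∘ Sat) ls →
                            Unique (variableVertices ls)
  variableVertices-unique ls vars-unique unsat =
    Unique.++⁺ (Unique.map⁺ literalVertex-injective (Unique.map⁻ vars-unique))
               (Unique.map⁺ negatedVertex-injective (Unique.map⁻ vars-unique))
               (All¬⇒Disjoint {P = AgreesWithα} (All.map⁺ {f = literalVertex} unsat)
                                              (All.map⁺ {f = negatedVertex} (All.map ¬-not unsat)))
    where
    vV-injective : ∀ {j j′ c c′} → vV {φ = φ} j c ≡ vV j′ c′ → (j , c) ≡ (j′ , c′)
    vV-injective refl = refl
    literalVertex-injective : ∀ {l l′} → literalVertex l ≡ literalVertex l′ → l ≡ l′
    literalVertex-injective = vV-injective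
    negatedVertex-injective : ∀ {l l′} → negatedVertex l ≡ negatedVertex l′ → l ≡ l′
    negatedVertex-injective e with vV-injective e
    ... | p = cong₂ _,_ (cong proj₁ p) (not-injective (cong proj₂ p))

  wreach-variableVertices : ∀ i → All (¬_ ∘ Sat) (clause i) →
                            All (Reach₂ (lowest i)) (variableVertices (clause i))
  wreach-variableVertices i unsat =
    All.++⁺ (All.map⁺ (All.tabulate wreach-literal))
            (All.map⁺ (All.tabulate λ l∈c → wreach-negated l∈c (All.lookup unsat l∈c)))

  wreach-fVertex : ∀ i (two : length (clause i) ≡ 2) a → Reach₂ (lowest i) (fV i two a)
  wreach-fVertex i two a =
    wreach-edge (s≤s z≤n) (inj₂ (f-u i two a _))
      (clause-neighbour-above-lowest i (λ k → inj₁ (f-u i two a k)) (λ ()))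

  SixWReach : Fin m → Set
  SixWReach i = ∃[ zs ] (length zs ≡ 6 × Unique zs × All (Reach₂ (lowest i)) zs)

  falsified-3-clause⇒six-wreach : ∀ i → length (clause i) ≡ 3 → All (¬_ ∘ Sat) (clause i) →
                                  SixWReach i
  falsified-3-clause⇒six-wreach i three unsat =
    variableVertices (clause i) ,
    trans (length-variableVertices (clause i)) (cong (λ k → k + k) three) ,
    variableVertices-unique _ (no-repeat i) unsat ,
    wreach-variableVertices i unsat

  falsified-2-clause⇒six-wreach : ∀ i → length (clause i) ≡ 2 → All (¬_ ∘ Sat) (clause i) →
                                  SixWReach i
  falsified-2-clause⇒six-wreach i two unsat =
    tabulate (fV i two) ++ variableVertices (clause i) ,
    cong (2 +_) (trans (length-variableVertices (clause i)) (cong (λ k → k + k) two)) ,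
    Unique.++⁺ (Unique.tabulate⁺ {f = fV i two} λ { refl → refl })
               (variableVertices-unique _ (no-repeat i) unsat)
               (All¬⇒Disjoint {P = IsVariableVertex} (All.tabulate⁺ {f = fV i two} λ _ ())
                                                     (variableVertices-variable (clause i))) ,
    All.++⁺ (All.tabulate⁺ (wreach-fVertex i two)) (wreach-variableVertices i unsat)
    where
    variableVertices-variable : ∀ ls → All IsVariableVertex (variableVertices ls)
    variableVertices-variable ls =
      All.++⁺ (All.map⁺ (All.universal _ ls)) (All.map⁺ (All.universal _ ls))

  falsified⇒six-wreach : ∀ i → ¬ Any Sat (clause i) → SixWReach i
  falsified⇒six-wreach i unsat =
    [ falsified-2-clause⇒six-wreach i , falsified-3-clause⇒six-wreach i ]′ (size i)
      (All.¬Any⇒All¬ (clause i) unsat)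

  ¬SixWReach : ∀ i → ¬ SixWReach i
  ¬SixWReach i (zs , six , zs-unique , zs-wreach) =
    1+n≰n (subst (_≤ 5) six (bound (lowest i) zs zs-unique zs-wreach))

  satisfying : Satisfiable φ
  satisfying = α , λ i →
    decidable-stable (any? (λ l → α (proj₁ l) ≟ᵇ proj₂ l) (clause i))
                     (¬SixWReach i ∘ falsified⇒six-wreach i)

lemma2 : ∀ {n m : ℕ} (φ : CNF n m) → Is2Clause3SAT φ → wcol≤ (Gφ φ) 2 5 → Satisfiable φ
lemma2 φ H (σ , bound) = Reduction.satisfying φ H σ bound
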